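{- Let $G\in\mathfrak{T}_a$ and $H\in\mathfrak{T}_a\cap\mathfrak{D}_r$ with $h_G=h_H$, and let $\sigma\in\mathcal{S}(G,H)$. Then for every $P\in\mathcal{P}^h_G$, $\iota_\sigma(P_{i-1},P_i)=2$ for all $1\le i\le h_G$; hence $$2\cdot h_H=\sum_{i=1}^{h_G}\iota_\sigma(P_{i-1},P_i)=\mu_{\sigma|_P}(P_\times).$$ In particular, $\mathcal{S}(G,H)\subseteq\mathcal{J}^{\mathcal{L}(G)}_{G,H}(\sigma)$.
   Context: A digraph $G=(V(G),A(G))$ has finite nonempty vertex set and arc set $A(G)\subseteq V(G)\times V(G)$; $vw$ denotes $(v,w)$; $G^*$ is $G$ with loops removed. $\mathfrak{D}_r$: reflexive digraphs; $\mathfrak{T}_a$: digraphs with $G^*$ acyclic. $\mathcal{H}(G,H)$: homomorphisms; $\mathcal{S}(G,H)=\mathcal{H}(G,H)\cap\mathcal{H}(G^*,H^*)$. A path is a sequence $P_0,\dots,P_{\ell(P)}$ of distinct vertices with $P_{i-1}P_i\in A(G)$ (in $G\in\mathfrak{T}_a$ identified with its vertex set $P$). $h_G$: largest path length; $\mathcal{P}^h_G$: paths of length $h_G$; $P_\times$: digraph with vertex set $P$ and arcs $P_{i-1}P_i$; $\mathcal{L}(G)=\{P_\times:P\in\mathcal{P}^h_G\}$. $[v,w]_H=\{u:vu,uw\in A(H)\}$, $\iota(v,w)_H=\#[v,w]_H$; for a homomorphism $\xi$ into $H$, $\iota_\xi(v,w)=\iota(\xi(v),\xi(w))_H$, $\iota_{\xi,B}$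 its restriction to $B$, and $\mu_\xi(L)=\sum_{vw\in A(L^*)}\iota_\xi(v,w)$. For a set $\mathcal{L}$ of subgraphs of $G$, $\mathcal{J}^{\mathcal{L}}_{G,H}(\sigma)=\{\tau\in\mathcal{H}(G,H):\iota_{\tau,A(L^*)}=\iota_{\sigma,A(L^*)}\ \forall L\in\mathcal{L}\}$. -}

module Defs where

open import Data.Nat using (ℕ; zero; suc; _+_; _≤_)
open import Data.Fin using (Fin; zero; suc; inject₁)
open import Data.Bool using (Bool; true; false; _∧_; if_then_else_)
open import Data.Product using (Σ; _×_; ∃)
open import Relation.Binary.PropositionalEquality using (_≡_; _≢_)
open import Relation.Nullary using (¬_)
open import Function.Definitions using (Injective)

record Digraph : Set where
  field
    size : ℕ
    arc  : Fin (suc size) → Fin (suc size) → Bool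

open Digraph public

V : Digraph → Set
V G = Fin (suc (size G))

Arc : (G : Digraph) → V G → V G → Set
Arc G v w = arc G v w ≡ true

sumFin : (k : ℕ) → (Fin k → ℕ) → ℕ
sumFin zero    f = 0
sumFin (suc k) f = f zero + sumFin k (λ i → f (suc i))

b2n : Bool → ℕ
b2n true  = 1
b2n false = 0

record Path (G : Digraph) (ℓ : ℕ) : Set where
  field
    vtx      : Fin (suc ℓ) → V G
    distinct : Injective _≡_ _≡_ vtx
    step     : (i : Fin ℓ) → Arc G (vtx (inject₁ i)) (vtx (suc i))

open Path public

IsReflexive : Digraph → Set
IsReflexive G = (v : V G) → Arc G v v

-- G ∈ 𝔗_a : G* (loops removed) has no directed cycle.  A cycle in G* is a
-- path P of length ℓ ≥ 1 (distinct vertices, non-loop arcs) closed by the arc P ℓ → P 0.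
IsAcyclicStar : Digraph → Set
IsAcyclicStar G = (ℓ : ℕ) → (P : Path G (suc ℓ)) →
  ¬ Arc G (vtx P (Data.Fin.fromℕ (suc ℓ))) (vtx P zero)

IsMaxPathLength : Digraph → ℕ → Set
IsMaxPathLength G h = Path G h × ((ℓ : ℕ) → Path G ℓ → ℓ ≤ h)

IsHom : (G H : Digraph) → (V G → V H) → Set
IsHom G H f = (v w : V G) → Arc G v w → Arc H (f v) (f w)

IsHomStar : (G H : Digraph) → (V G → V H) → Set
IsHomStar G H f = (v w : V G) → v ≢ w → Arc G v w → (f v ≢ f w) × Arc H (f v) (f w)

IsS : (G H : Digraph) → (V G → V H) → Set
IsS G H f = IsHom G H f × IsHomStar G H f

ι : (H : Digraph) → V H → V H → ℕ
ι H v w = sumFin (suc (size H)) (λ u → b2n (arc H v u ∧ arc H u w))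

ι[_,_] : (G H : Digraph) → (V G → V H) → V G → V G → ℕ
ι[ G , H ] ξ v w = ι H (ξ v) (ξ w)

-- μ_{ξ|P}(P_×) : sum of ι_ξ over the arcs of (P_×)* , which are exactly
-- the arcs P (i-1) P i , 1 ≤ i ≤ ℓ (pairwise distinct, none a loop).
μ-path : (G H : Digraph) → (V G → V H) → {ℓ : ℕ} → Path G ℓ → ℕ
μ-path G H ξ {ℓ} P = sumFin ℓ (λ i → ι[ G , H ] ξ (vtx P (inject₁ i)) (vtx P (suc i)))

-- τ ∈ 𝒥^{ℒ(G)}_{G,H}(σ), with ℒ(G) = { P_× : P ∈ 𝒫^h_G } where h = h_G
InJ : (G H : Digraph) (h : ℕ) → (σ τ : V G → V H) → Set
InJ G H h σ τ = IsHom G H τ ×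
  ((P : Path G h) → (i : Fin h) →
     ι[ G , H ] τ (vtx P (inject₁ i)) (vtx P (suc i)) ≡ ι[ G , H ] σ (vtx P (inject₁ i)) (vtx P (suc i)))

module Submission where

-- Let σ ∈ 𝒮(G,H) and let P be a longest path of G, of length
-- h = h_G = h_H.  As σ maps non-loop arcs to non-loop arcs, σ(P_0), …, σ(P_h) is a
-- walk in H*.
--  (1) If H* is acyclic, every walk in H* is a path: a first repeated vertex
--      would close a directed cycle.
--  (2) Hence no arc σ(P_{i-1})σ(P_i) admits a detour u ∉ {σ(P_{i-1}), σ(P_i)}:
--      inserting u would give a walk, hence a path, of length h + 1 > h_H.
--  (3) H is reflexive, so [σ(P_{i-1}), σ(P_i)]_H contains both endpoints and,
--      by (2), nothing else; thus ι_σ(P_{i-1},P_i) = 2.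
-- The sum of these values is 2h, it is μ_{σ|P}(P_×) by definition, and every
-- τ ∈ 𝒮(G,H) takes the same value 2, whence 𝒮(G,H) ⊆ 𝒥^{ℒ(G)}_{G,H}(σ).

open import Defs
open import Data.Nat using (ℕ; zero; suc; _+_; _*_; _≤_; _<_; z≤n; s≤s)
open import Data.Nat.Properties
  using (≤-refl; <-irrefl; m≤n⇒m<n∨m≡n; m≤n⇒m≤1+n; ≤-pred; +-suc; +-identityʳ;
         +-monoʳ-≤; +-monoʳ-<; +-cancelˡ-≡; *-comm; *-zeroʳ; +-commutativeSemigroup;
         m≤n⇒∃[o]m+o≡n)
open import Algebra.Properties.CommutativeSemigroup +-commutativeSemigroup using (interchange)
open import Data.Fin using (Fin; zero; suc; inject₁; toℕ; fromℕ; fromℕ<; _≟_)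
open import Data.Fin.Properties using (toℕ<n; toℕ-inject₁; toℕ-fromℕ<; toℕ-fromℕ; toℕ-injective; suc-injective)
open import Data.Product using (_×_; _,_; proj₁; proj₂)
open import Data.Sum using (_⊎_; inj₁; inj₂)
open import Data.Bool using (Bool; true; false; _∧_)
open import Data.Empty using (⊥; ⊥-elim)
open import Function using (_∘_)
open import Relation.Nullary using (yes; no)
open import Relation.Binary.PropositionalEquality

sumFin-cong : ∀ n {f g : Fin n → ℕ} → (∀ i → f i ≡ g i) → sumFin n f ≡ sumFin n g
sumFin-cong zero    f≗g = refl
sumFin-cong (suc n) f≗g = cong₂ _+_ (f≗g zero) (sumFin-cong n (f≗g ∘ suc))

sumFin-+ : ∀ n (f g : Fin n → ℕ) → sumFin n (λ i → f i + g i) ≡ sumFin n f + sumFin n g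
sumFin-+ zero    f g = refl
sumFin-+ (suc n) f g = begin
  f zero + g zero + sumFin n (λ i → f (suc i) + g (suc i))
    ≡⟨ cong (f zero + g zero +_) (sumFin-+ n (f ∘ suc) (g ∘ suc)) ⟩
  f zero + g zero + (sumFin n (f ∘ suc) + sumFin n (g ∘ suc))
    ≡⟨ interchange (f zero) (g zero) _ _ ⟩
  f zero + sumFin n (f ∘ suc) + (g zero + sumFin n (g ∘ suc)) ∎
  where open ≡-Reasoning

sumFin-const : ∀ n c → sumFin n (λ _ → c) ≡ n * c
sumFin-const zero    c = refl
sumFin-const (suc n) c = cong (c +_) (sumFin-const n c)

indicator : ∀ {n} → Fin n → Fin n → ℕ
indicator zero    zero    = 1
indicator zero    (suc _) = 0
indicator (suc _) zero    = 0
indicator (suc a) (suc u) = indicator a u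

indicator-self : ∀ {n} (a : Fin n) → indicator a a ≡ 1
indicator-self zero    = refl
indicator-self (suc a) = indicator-self a

indicator-other : ∀ {n} (a u : Fin n) → a ≢ u → indicator a u ≡ 0
indicator-other zero    zero    a≢u = ⊥-elim (a≢u refl)
indicator-other zero    (suc u) _   = refl
indicator-other (suc a) zero    _   = refl
indicator-other (suc a) (suc u) a≢u = indicator-other a u (a≢u ∘ cong suc)

sumFin-indicator : ∀ n (a : Fin n) → sumFin n (indicator a) ≡ 1
sumFin-indicator (suc n) zero    = cong suc (trans (sumFin-const n 0) (*-zeroʳ n))
sumFin-indicator (suc n) (suc a) = sumFin-indicator n a

count-two : ∀ n (F : Fin n → Bool) (a b : Fin n) → a ≢ b → F a ≡ true → F b ≡ true →
            (∀ u → F u ≡ true → u ≡ a ⊎ u ≡ b) → sumFin n (b2n ∘ F) ≡ 2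
count-two n F a b a≢b Fa Fb only = begin
  sumFin n (b2n ∘ F)                                 ≡⟨ sumFin-cong n pointwise ⟩
  sumFin n (λ u → indicator a u + indicator b u)     ≡⟨ sumFin-+ n (indicator a) (indicator b) ⟩
  sumFin n (indicator a) + sumFin n (indicator b)    ≡⟨ cong₂ _+_ (sumFin-indicator n a) (sumFin-indicator n b) ⟩
  2                                                  ∎
  where
  open ≡-Reasoning
  pointwise : ∀ u → b2n (F u) ≡ indicator a u + indicator b u
  pointwise u with a ≟ u | b ≟ u
  ... | yes refl | _        =
    trans (cong b2n Fa) (sym (cong₂ _+_ (indicator-self a) (indicator-other b a (a≢b ∘ sym))))
  ... | no _     | yes refl =
    trans (cong b2n Fb) (sym (cong₂ _+_ (indicator-other a b a≢b) (indicator-self b)))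
  ... | no a≢u   | no b≢u with F u in Fu
  ...   | false = sym (cong₂ _+_ (indicator-other a u a≢u) (indicator-other b u b≢u))
  ...   | true with only u Fu
  ...     | inj₁ u≡a = ⊥-elim (a≢u (sym u≡a))
  ...     | inj₂ u≡b = ⊥-elim (b≢u (sym u≡b))

-- Walks in H* as ℕ-indexed vertex sequences; only the values at 0 … n matter.
module WalksIn (H : Digraph) where

  StarArc : V H → V H → Set
  StarArc v w = (v ≢ w) × Arc H v w

  Walk : (ℕ → V H) → ℕ → Set
  Walk f n = ∀ k → k < n → StarArc (f k) (f (suc k))

  InjectiveUpTo : (ℕ → V H) → ℕ → Set
  InjectiveUpTo f n = ∀ {i j} → i ≤ n → j ≤ n → f i ≡ f j → i ≡ j

  walk-prefix : ∀ {f n} → Walk f (suc n) → Walk f n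
  walk-prefix walk k k<n = walk k (m≤n⇒m≤1+n k<n)

  walk-suffix : ∀ {f} i {n} → Walk f (i + n) → Walk (λ k → f (i + k)) n
  walk-suffix {f} i walk k k<n =
    subst (λ x → StarArc (f (i + k)) (f x)) (sym (+-suc i k)) (walk (i + k) (+-monoʳ-< i k<n))

  injective-suffix : ∀ {f} i {n} → InjectiveUpTo f (i + n) → InjectiveUpTo (λ k → f (i + k)) n
  injective-suffix i inj i≤n j≤n eq = +-cancelˡ-≡ i _ _ (inj (+-monoʳ-≤ i i≤n) (+-monoʳ-≤ i j≤n) eq)

  injective-extend : ∀ {f} m → InjectiveUpTo f m → (∀ {i} → i ≤ m → f i ≢ f (suc m)) →
                     InjectiveUpTo f (suc m)
  injective-extend m inj new i≤ j≤ eq with m≤n⇒m<n∨m≡n i≤ | m≤n⇒m<n∨m≡n j≤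
  ... | inj₁ i<   | inj₁ j<   = inj (≤-pred i<) (≤-pred j<) eq
  ... | inj₂ refl | inj₂ refl = refl
  ... | inj₁ i<   | inj₂ refl = ⊥-elim (new (≤-pred i<) eq)
  ... | inj₂ refl | inj₁ j<   = ⊥-elim (new (≤-pred j<) (sym eq))

  walk→path : ∀ {f} n → Walk f n → InjectiveUpTo f n → Path H n
  vtx      (walk→path {f} n walk inj) x = f (toℕ x)
  distinct (walk→path n _ inj) {x} {y} eq =
    toℕ-injective (inj (≤-pred (toℕ<n x)) (≤-pred (toℕ<n y)) eq)
  step     (walk→path {f} n walk _) j =
    subst (λ k → Arc H (f k) (f (suc (toℕ j)))) (sym (toℕ-inject₁ j)) (proj₂ (walk (toℕ j) (toℕ<n j)))

  insertAfter : (ℕ → V H) → ℕ → V H → ℕ → V H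
  insertAfter f p       u zero          = f zero
  insertAfter f zero    u (suc zero)    = u
  insertAfter f zero    u (suc (suc k)) = f (suc k)
  insertAfter f (suc p) u (suc k)       = insertAfter (f ∘ suc) p u k

  insert-walk : ∀ {f} n p {u} → Walk f n → p < n →
                StarArc (f p) u → StarArc u (f (suc p)) → Walk (insertAfter f p u) (suc n)
  insert-walk n       zero    walk _          into out zero          _         = into
  insert-walk n       zero    walk _          into out (suc zero)    _         = out
  insert-walk n       zero    walk _          into out (suc (suc k)) (s≤s k<n) = walk (suc k) k<n
  insert-walk (suc n) (suc p) walk _          into out zero          _         = walk zero (s≤s z≤n)
  insert-walk (suc n) (suc p) walk (s≤s p<n) into out (suc k) (s≤s k<n) =
    insert-walk n p (λ k k<n → walk (suc k) (s≤s k<n)) p<n into out k k<n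

  module _ (acyclic : IsAcyclicStar H) where

    -- For i = m this holds as arcs of H* are no loops; for
    -- m = i + 1 + l the segment f i … f m is a path of length 1 + l which the
    -- arc f m → f (m+1) = f i would close to a cycle of H*.
    walk-last-new : ∀ {f} m → Walk f (suc m) → InjectiveUpTo f m →
                    ∀ {i} → i ≤ m → f i ≢ f (suc m)
    walk-last-new {f} m walk inj {i} i≤m with m≤n⇒m<n∨m≡n i≤m
    ... | inj₂ refl = proj₁ (walk i ≤-refl)
    ... | inj₁ i<m with m≤n⇒∃[o]m+o≡n i<m
    ... | l , refl = λ fi≡flast → acyclic l segment (subst₂ (Arc H) last≡ (sym first≡) (closing fi≡flast))
      where
      i+[1+l]≡1+[i+l] : i + suc l ≡ suc (i + l)
      i+[1+l]≡1+[i+l] = +-suc i l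
      segment : Path H (suc l)
      segment = walk→path (suc l)
        (walk-suffix i (subst (Walk f) (sym i+[1+l]≡1+[i+l]) (walk-prefix walk)))
        (injective-suffix i (subst (InjectiveUpTo f) (sym i+[1+l]≡1+[i+l]) inj))
      last≡ : f (suc (i + l)) ≡ vtx segment (fromℕ (suc l))
      last≡ = cong f (trans (sym i+[1+l]≡1+[i+l]) (cong (i +_) (sym (toℕ-fromℕ (suc l)))))
      first≡ : vtx segment zero ≡ f i
      first≡ = cong f (+-identityʳ i)
      closing : f i ≡ f (suc (suc (i + l))) → Arc H (f (suc (i + l))) (f i)
      closing eq = subst (Arc H _) (sym eq) (proj₂ (walk (suc (i + l)) ≤-refl))

    walk-injective : ∀ {f} n → Walk f n → InjectiveUpTo f n
    walk-injective zero    walk z≤n z≤n _ = refl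
    walk-injective (suc m) walk = injective-extend m earlier (walk-last-new m walk earlier)
      where earlier = walk-injective m (walk-prefix walk)

    -- (2) On a walk of maximal length h_H no arc admits a detour through a third
    -- vertex: the longer walk obtained by inserting it would be a path.
    no-detour : ∀ {f} n → ((ℓ : ℕ) → Path H ℓ → ℓ ≤ n) → Walk f n → ∀ {p u} → p < n →
                StarArc (f p) u → StarArc u (f (suc p)) → ⊥
    no-detour {f} n longest walk {p} {u} p<n into out = <-irrefl refl (longest (suc n) longer)
      where
      detour : Walk (insertAfter f p u) (suc n)
      detour = insert-walk n p walk p<n into out
      longer : Path H (suc n)
      longer = walk→path (suc n) detour (walk-injective (suc n) detour)

-- Reading an index k : ℕ as an element of Fin (suc n), saturating at n.
clamp : ∀ {n} → ℕ → Fin (suc n)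
clamp           zero    = zero
clamp {zero}    (suc k) = zero
clamp {suc n}   (suc k) = suc (clamp k)

clamp-toℕ : ∀ {n} (j : Fin n) → clamp {n} (toℕ j) ≡ inject₁ j
clamp-toℕ zero    = refl
clamp-toℕ (suc j) = cong suc (clamp-toℕ j)

clamp-suc-toℕ : ∀ {n} (j : Fin n) → clamp {n} (suc (toℕ j)) ≡ suc j
clamp-suc-toℕ {suc n} zero    = refl
clamp-suc-toℕ {suc n} (suc j) = cong suc (clamp-suc-toℕ j)

inject₁≢suc : ∀ {n} (j : Fin n) → inject₁ j ≢ suc j
inject₁≢suc zero    ()
inject₁≢suc (suc j) eq = inject₁≢suc j (suc-injective eq)

module ImageOfPath (G H : Digraph) (σ : V G → V H) (σ* : IsHomStar G H σ) {n : ℕ} (P : Path G n) where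
  open WalksIn H

  -- σ(P_0), …, σ(P_n), continued constantly beyond n.
  image : ℕ → V H
  image k = σ (vtx P (clamp k))

  -- Consecutive vertices of a path are distinct, so σ maps each arc of P to an arc of H*.
  image-arc : (j : Fin n) → StarArc (σ (vtx P (inject₁ j))) (σ (vtx P (suc j)))
  image-arc j = σ* _ _ (inject₁≢suc j ∘ distinct P) (step P j)

  image-arc-toℕ : (j : Fin n) → StarArc (image (toℕ j)) (image (suc (toℕ j)))
  image-arc-toℕ j =
    subst₂ (λ x y → StarArc (σ (vtx P x)) (σ (vtx P y))) (sym (clamp-toℕ j)) (sym (clamp-suc-toℕ j))
      (image-arc j)

  image-walk : Walk image n
  image-walk k k<n = subst (λ x → StarArc (image x) (image (suc x))) (toℕ-fromℕ< k<n)
    (image-arc-toℕ (fromℕ< k<n))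

∧-intro : ∀ {x y} → x ≡ true → y ≡ true → x ∧ y ≡ true
∧-intro refl refl = refl

∧-elim : ∀ {x y} → x ∧ y ≡ true → x ≡ true × y ≡ true
∧-elim {true} {true} _ = refl , refl

ι-two : (H : Digraph) → IsReflexive H → ∀ {a b} → a ≢ b → Arc H a b →
        (∀ u → Arc H a u → Arc H u b → u ≡ a ⊎ u ≡ b) → ι H a b ≡ 2
ι-two H reflexive {a} {b} a≢b a→b only =
  count-two _ _ a b a≢b (∧-intro (reflexive a) a→b) (∧-intro a→b (reflexive b))
    (λ u a→u→b → only u (proj₁ (∧-elim a→u→b)) (proj₂ (∧-elim a→u→b)))

ι-on-longest-path : (G H : Digraph) → IsAcyclicStar H → IsReflexive H →
  (h : ℕ) → IsMaxPathLength H h → (σ : V G → V H) → IsHomStar G H σ →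
  (P : Path G h) (i : Fin h) → ι[ G , H ] σ (vtx P (inject₁ i)) (vtx P (suc i)) ≡ 2
ι-on-longest-path G H acyclic reflexive h (_ , longest) σ σ* P i =
  ι-two H reflexive (proj₁ (image-arc i)) (proj₂ (image-arc i)) only
  where
  open WalksIn H
  open ImageOfPath G H σ σ* P
  a b : V H
  a = σ (vtx P (inject₁ i))
  b = σ (vtx P (suc i))
  only : ∀ u → Arc H a u → Arc H u b → u ≡ a ⊎ u ≡ b
  only u a→u u→b with u ≟ a | u ≟ b
  ... | yes u≡a | _       = inj₁ u≡a
  ... | no _    | yes u≡b = inj₂ u≡b
  ... | no u≢a  | no u≢b  = ⊥-elim (no-detour acyclic h longest image-walk (toℕ<n i) into out)
    where
    into : StarArc (image (toℕ i)) u
    into = subst (λ x → StarArc (σ (vtx P x)) u) (sym (clamp-toℕ i)) (u≢a ∘ sym , a→u)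
    out : StarArc u (image (suc (toℕ i)))
    out = subst (λ x → StarArc u (σ (vtx P x))) (sym (clamp-suc-toℕ i)) (u≢b , u→b)

corollary5 : (G H : Digraph) → IsAcyclicStar G → IsAcyclicStar H → IsReflexive H →
    (h : ℕ) → IsMaxPathLength G h → IsMaxPathLength H h →
    (σ : V G → V H) → IsS G H σ →
    ((P : Path G h) →
       ((i : Fin h) → ι[ G , H ] σ (vtx P (inject₁ i)) (vtx P (suc i)) ≡ 2)
       × (2 * h ≡ sumFin h (λ i → ι[ G , H ] σ (vtx P (inject₁ i)) (vtx P (suc i))))
       × (sumFin h (λ i → ι[ G , H ] σ (vtx P (inject₁ i)) (vtx P (suc i))) ≡ μ-path G H σ P))
    × ((τ : V G → V H) → IsS G H τ → InJ G H h σ τ)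
corollary5 G H _ acyclicH reflexiveH h _ maxH σ (_ , σ*) =
  (λ P → two σ σ* P , sum-is-2h P , refl) , in-J
  where
  two : (ξ : V G → V H) → IsHomStar G H ξ → (P : Path G h) (i : Fin h) →
        ι[ G , H ] ξ (vtx P (inject₁ i)) (vtx P (suc i)) ≡ 2
  two = ι-on-longest-path G H acyclicH reflexiveH h maxH
  sum-is-2h : (P : Path G h) → 2 * h ≡ sumFin h (λ i → ι[ G , H ] σ (vtx P (inject₁ i)) (vtx P (suc i)))
  sum-is-2h P = begin
    2 * h                  ≡⟨ *-comm 2 h ⟩
    h * 2                  ≡⟨ sym (sumFin-const h 2) ⟩
    sumFin h (λ _ → 2)     ≡⟨ sumFin-cong h (sym ∘ two σ σ* P) ⟩
    sumFin h (λ i → ι[ G , H ] σ (vtx P (inject₁ i)) (vtx P (suc i))) ∎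
    where open ≡-Reasoning
  in-J : (τ : V G → V H) → IsS G H τ → InJ G H h σ τ
  in-J τ (τ-hom , τ*) = τ-hom , λ P i → trans (two τ τ* P i) (sym (two σ σ* P i))
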